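{- Let $k\ge 3$, $g\ge 1$ and $c\ge 2$ be integers such that a transversal design {\rm TD}$(k,g)$ exists, let $v=kg$, and suppose $c$ divides $k$. Write $k=qc+b$ and $v=\rho c+\beta$ with integers $q,\rho$ and $0\le b<c$, $0\le \beta<c$. Then there exists a block-equitably $c$-coloured packing {\rm PD}$(v,k,1)$ whose number of blocks equals \[ \frac{\rho\left(\frac{\rho c}{2}+\beta\right)(c-1)+\frac{\beta}{2}(\beta-1)}{q\left(\frac{qc}{2}+b\right)(c-1)+\frac{b}{2}(b-1)}. \]
   Context: A transversal design {\rm TD}$(k,g)$ is a set of $kg$ points partitioned into $k$ groups of size $g$, together with a collection of $k$-subsets (blocks) such that every pair of points from distinct groups lies in exactly one block and no pair from the same group lies in a block. A packing design {\rm PD}$(v,k,1)$ is a pair $(V,{\cal B})$ with $|V|=v$ and ${\cal B}$ a collection of $k$-subsets of $V$ such that every pair of points lies in at most one block; its size is $|{\cal B}|$. A $c$-colouring is a function $f:V\to{\cal C}$ with $|{\cal C}|=c$, colour classes $F(\gamma)=f^{ -1}(\gamma)$; it is block-equitable if $\lfloor k/c\rfloor\le |B\cap F(\gamma)|\le\lceil k/c\rceil$ for every colour $\gamma$ and block $B$. -}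

module Defs where

open import Data.Nat using (ℕ; _+_; _*_; _∸_; _≤_; _/_; NonZero)
open import Data.Fin using (Fin; _≟_)
open import Data.Fin.Subset using (Subset; _∈_; _∩_; ∣_∣)
open import Data.Fin.Subset.Properties using (_∈?_)
open import Data.List using (List; filter; length)
open import Data.List.Membership.Propositional renaming (_∈_ to _∈ₗ_)
open import Data.Vec using (tabulate)
open import Data.Product using (Σ; ∃; _×_)
open import Relation.Nullary using (¬_; does)
open import Relation.Nullary.Decidable using (_×-dec_)
open import Relation.Binary.PropositionalEquality using (_≡_)

pairCount : ∀ {v} → List (Subset v) → Fin v → Fin v → ℕ
pairCount Bs x y = length (filter (λ B → (x ∈? B) ×-dec (y ∈? B)) Bs)

groupSize : ∀ {v k} → (Fin v → Fin k) → Fin k → ℕ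
groupSize {v} grp i = ∣ tabulate {n = v} (λ x → does (grp x ≟ i)) ∣

record TD (k g : ℕ) : Set where
  field
    grp       : Fin (k * g) → Fin k
    grpSize   : ∀ i → groupSize grp i ≡ g
    blocks    : List (Subset (k * g))
    blockSize : ∀ B → B ∈ₗ blocks → ∣ B ∣ ≡ k
    crossPair : ∀ x y → ¬ (grp x ≡ grp y) → pairCount blocks x y ≡ 1
    samePair  : ∀ x y → ¬ (x ≡ y) → grp x ≡ grp y → pairCount blocks x y ≡ 0

TDExists : ℕ → ℕ → Set
TDExists k g = TD k g

IsPacking : (v k : ℕ) → List (Subset v) → Set
IsPacking v k Bs =
  (∀ B → B ∈ₗ Bs → ∣ B ∣ ≡ k) ×
  (∀ x y → ¬ (x ≡ y) → pairCount Bs x y ≤ 1)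

colourClass : ∀ {v c} → (Fin v → Fin c) → Fin c → Subset v
colourClass f γ = tabulate (λ x → does (f x ≟ γ))

⌈_/_⌉ : (k c : ℕ) .{{_ : NonZero c}} → ℕ
⌈ k / c ⌉ = (k + (c ∸ 1)) / c

BlockEquitable : ∀ {v} (k c : ℕ) .{{_ : NonZero c}} →
                 List (Subset v) → (Fin v → Fin c) → Set
BlockEquitable k c Bs f =
  ∀ B → B ∈ₗ Bs → ∀ γ →
    (k / c ≤ ∣ B ∩ colourClass f γ ∣) × (∣ B ∩ colourClass f γ ∣ ≤ ⌈ k / c ⌉)

-- Since c ∣ k and hence c ∣ kg, the remainders b and β vanish, k = qc and ρ = qg, so the claimed
-- size is g². The blocks of the TD already form such a packing: a block has k points and meets each
-- of the k groups at most once (pairs inside a group are never covered), hence exactly once. So a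
-- point lies in g blocks (one for each point of any other group), and counting incidences between
-- blocks and the points of one group gives g · g blocks. Colour the groups so that every colour is
-- used on q = k/c groups and give each point the colour of its group: each block then meets every
-- colour class in exactly q points.

module Submission where

open import Defs
open import Data.Nat using (ℕ; _+_; _*_; _∸_; _≤_; _<_; NonZero)
open import Data.Nat.Divisibility using (_∣_)
open import Data.Fin using (Fin)
open import Data.Fin.Subset using (Subset)
open import Data.List using (List; length)
open import Data.Product using (Σ; _×_)
open import Relation.Binary.PropositionalEquality using (_≡_)

open import Algebra.Properties.CommutativeSemigroup using (x∙yz≈y∙xz; xy∙z≈xz∙y)
open import Data.Bool.Base using (Bool; true; false; _∧_)
open import Data.Empty using (⊥-elim)
open import Data.Fin.Base using (zero; suc; _↑ˡ_; _↑ʳ_; combine; remainder)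
open import Data.Fin.Properties using (_≟_; suc-injective; 0≢1+n; remQuot-combine)
open import Data.Fin.Subset using (_∈_; _∩_; ∣_∣)
open import Data.Fin.Subset.Properties using (_∈?_)
open import Data.List.Base using ([]; _∷_; filter; lookup)
open import Data.List.Membership.Propositional using () renaming (_∈_ to _∈ₗ_)
open import Data.List.Membership.Propositional.Properties using (∈-filter⁺; ∈-lookup)
open import Data.List.Relation.Unary.Any using (here; there)
open import Data.Nat.Base using (zero; suc; _/_; z≤n; s≤s)
open import Data.Nat.Divisibility using (>⇒∤; ∣m+n∣m⇒∣n; n∣m*n; ∣m⇒∣m*n)
open import Data.Nat.DivMod using (m*n/n≡m; m<n⇒m/n≡0; +-distrib-/-∣ˡ)
open import Data.Nat.Properties
  using (+-*-semiring; *-commutativeSemigroup; +-assoc; +-identityʳ; *-identityʳ; *-comm;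
         +-cancelˡ-≡; *-cancelʳ-≡; ≤-refl; ≤-reflexive; ≤-trans; ≤-antisym; <⇒≤; 1+n≰n;
         +-cancelʳ-≤; +-mono-≤; +-monoʳ-≤; *-mono-≤; m*n≡1⇒m≡1; m*n≡1⇒n≡1;
         m≤pred[n]⇒suc[m]≤n)
open import Data.Nat.Tactic.RingSolver using (solve-∀)
open import Data.Product.Base using (Σ-syntax; _,_; proj₂)
open import Data.Vec.Base using ([]; _∷_; tabulate)
open import Function.Base using (_∘_)
open import Function.Bundles using (mk⇔)
open import Relation.Nullary.Decidable using (Dec; yes; no; does; does-⇔)
open import Relation.Unary using (Pred; Decidable)
open import Relation.Binary.PropositionalEquality
  using (_≢_; refl; sym; trans; cong; cong₂; subst; module ≡-Reasoning)
open import Algebra.Properties.Semiring.Sum +-*-semiring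
  using (sum-syntax; sum-cong-≗; ∑-comm; *-distribˡ-sum; *-distribʳ-sum; sum-replicate-zero)

open ≡-Reasoning

𝟙 : Bool → ℕ
𝟙 true  = 1
𝟙 false = 0

𝟙-∧ : ∀ a b → 𝟙 (a ∧ b) ≡ 𝟙 a * 𝟙 b
𝟙-∧ true  b = sym (+-identityʳ (𝟙 b))
𝟙-∧ false b = refl

𝟙≤1 : ∀ a → 𝟙 a ≤ 1
𝟙≤1 true  = s≤s z≤n
𝟙≤1 false = z≤n

𝟙-does≡1⇒ : ∀ {a} {A : Set a} (a? : Dec A) → 𝟙 (does a?) ≡ 1 → A
𝟙-does≡1⇒ (yes a) _ = a

𝟙-does-*-cong : ∀ {a} {A : Set a} (a? : Dec A) {m n : ℕ} →
                (A → m ≡ n) → 𝟙 (does a?) * m ≡ 𝟙 (does a?) * n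
𝟙-does-*-cong (yes a) m≡n = cong (_+ 0) (m≡n a)
𝟙-does-*-cong (no _)  _   = refl

does-≟-sym : ∀ {n} (i j : Fin n) → does (i ≟ j) ≡ does (j ≟ i)
does-≟-sym i j = does-⇔ (mk⇔ sym sym) (i ≟ j) (j ≟ i)

∑-ones : ∀ n → ∑[ i < n ] 1 ≡ n
∑-ones zero    = refl
∑-ones (suc n) = cong suc (∑-ones n)

∑-zero : ∀ {n} {f : Fin n → ℕ} → (∀ i → f i ≡ 0) → ∑[ i < n ] f i ≡ 0
∑-zero {n} f≗0 = trans (sum-cong-≗ f≗0) (sum-replicate-zero n)

∑-mono-≤ : ∀ {n} {f h : Fin n → ℕ} → (∀ i → f i ≤ h i) → ∑[ i < n ] f i ≤ ∑[ i < n ] h i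
∑-mono-≤ {zero}  f≤h = z≤n
∑-mono-≤ {suc n} f≤h = +-mono-≤ (f≤h zero) (∑-mono-≤ (f≤h ∘ suc))

∑-mono-≤-≡⇒≗ : ∀ {n} {f h : Fin n → ℕ} → (∀ i → f i ≤ h i) →
                ∑[ i < n ] f i ≡ ∑[ i < n ] h i → ∀ i → f i ≡ h i
∑-mono-≤-≡⇒≗ {suc n} {f} {h} f≤h eq = λ where
    zero    → head-eq
    (suc i) → ∑-mono-≤-≡⇒≗ (f≤h ∘ suc) tail-eq i
  where
  head-eq : f zero ≡ h zero
  head-eq = ≤-antisym (f≤h zero) (+-cancelʳ-≤ _ (h zero) (f zero)
    (≤-trans (+-monoʳ-≤ (h zero) (∑-mono-≤ (f≤h ∘ suc))) (≤-reflexive (sym eq))))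
  tail-eq : ∑[ i < n ] f (suc i) ≡ ∑[ i < n ] h (suc i)
  tail-eq = +-cancelˡ-≡ (f zero) _ _ (trans eq (cong (_+ _) (sym head-eq)))

∑-≤1 : ∀ {n} (f : Fin n → ℕ) → (∀ i → f i ≤ 1) →
       (∀ i j → f i ≡ 1 → f j ≡ 1 → i ≡ j) → ∑[ i < n ] f i ≤ 1
∑-≤1 {zero}  f f≤1 unique = z≤n
∑-≤1 {suc n} f f≤1 unique with f zero in f₀≡ | f≤1 zero
... | zero        | _      =
  ∑-≤1 (f ∘ suc) (f≤1 ∘ suc) λ i j fi fj → suc-injective (unique (suc i) (suc j) fi fj)
... | suc (suc _) | s≤s ()
... | suc zero    | _      = ≤-reflexive (cong suc (∑-zero tail≡0))
  where
  tail≡0 : ∀ i → f (suc i) ≡ 0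
  tail≡0 i with f (suc i) in fᵢ≡ | f≤1 (suc i)
  ... | zero        | _      = refl
  ... | suc (suc _) | s≤s ()
  ... | suc zero    | _      = ⊥-elim (0≢1+n (unique zero (suc i) f₀≡ fᵢ≡))

∑-δ : ∀ {n} (j : Fin n) (w : Fin n → ℕ) → ∑[ i < n ] (𝟙 (does (j ≟ i)) * w i) ≡ w j
∑-δ {suc n} zero    w = begin
  w zero + 0 + ∑[ i < n ] 0  ≡⟨ cong (w zero + 0 +_) (∑-zero {n} λ _ → refl) ⟩
  w zero + 0 + 0             ≡⟨ trans (+-identityʳ _) (+-identityʳ _) ⟩
  w zero                     ∎
∑-δ {suc n} (suc j) w = ∑-δ j (w ∘ suc)

∑-𝟙-≟≡1 : ∀ {n} (j : Fin n) → ∑[ i < n ] 𝟙 (does (i ≟ j)) ≡ 1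
∑-𝟙-≟≡1 {n} j = begin
  ∑[ i < n ] 𝟙 (does (i ≟ j))        ≡⟨ sum-cong-≗ (λ i → cong 𝟙 (does-≟-sym i j)) ⟩
  ∑[ i < n ] 𝟙 (does (j ≟ i))        ≡⟨ sum-cong-≗ (λ i → *-identityʳ (𝟙 (does (j ≟ i)))) ⟨
  ∑[ i < n ] (𝟙 (does (j ≟ i)) * 1)  ≡⟨ ∑-δ j (λ _ → 1) ⟩
  1                                  ∎

∑-↑ : ∀ m {n} (f : Fin (m + n) → ℕ) →
      ∑[ i < m + n ] f i ≡ ∑[ i < m ] f (i ↑ˡ n) + ∑[ j < n ] f (m ↑ʳ j)
∑-↑ zero    f = refl
∑-↑ (suc m) f = trans (cong (f zero +_) (∑-↑ m (f ∘ suc))) (sym (+-assoc (f zero) _ _))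

∑-combine : ∀ m {n} (f : Fin (m * n) → ℕ) →
            ∑[ i < m * n ] f i ≡ ∑[ a < m ] ∑[ j < n ] f (combine a j)
∑-combine zero    f = refl
∑-combine (suc m) {n} f =
  trans (∑-↑ n f) (cong (∑[ j < n ] f (j ↑ˡ m * n) +_) (∑-combine m (f ∘ (n ↑ʳ_))))

∣p∣≡∑ : ∀ {n} (p : Subset n) → ∣ p ∣ ≡ ∑[ x < n ] 𝟙 (does (x ∈? p))
∣p∣≡∑ []          = refl
∣p∣≡∑ (true  ∷ p) = cong suc (∣p∣≡∑ p)
∣p∣≡∑ (false ∷ p) = ∣p∣≡∑ p

does-∈?-∩ : ∀ {n} (x : Fin n) (p q : Subset n) →
            does (x ∈? p ∩ q) ≡ does (x ∈? p) ∧ does (x ∈? q)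
does-∈?-∩ zero    (true  ∷ p) (true  ∷ q) = refl
does-∈?-∩ zero    (true  ∷ p) (false ∷ q) = refl
does-∈?-∩ zero    (false ∷ p) (_     ∷ q) = refl
does-∈?-∩ (suc x) (_     ∷ p) (_     ∷ q) = does-∈?-∩ x p q

does-∈?-tabulate : ∀ {n} (x : Fin n) (f : Fin n → Bool) → does (x ∈? tabulate f) ≡ f x
does-∈?-tabulate {suc n} zero f with f zero
... | true  = refl
... | false = refl
does-∈?-tabulate {suc n} (suc x) f = does-∈?-tabulate x (f ∘ suc)

length-filter≡∑ : ∀ {a p} {A : Set a} {P : Pred A p} (P? : Decidable P) (xs : List A) →
                  length (filter P? xs) ≡ ∑[ b < length xs ] 𝟙 (does (P? (lookup xs b)))
length-filter≡∑ P? []       = refl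
length-filter≡∑ P? (x ∷ xs) with does (P? x)
... | true  = cong suc (length-filter≡∑ P? xs)
... | false = length-filter≡∑ P? xs

∑-*-∑-swap : ∀ {m n} (u : Fin m → ℕ) (v : Fin n → ℕ) (w : Fin m → Fin n → ℕ) →
             ∑[ a < m ] (u a * ∑[ b < n ] (v b * w a b)) ≡
             ∑[ b < n ] (v b * ∑[ a < m ] (u a * w a b))
∑-*-∑-swap {m} {n} u v w = begin
  ∑[ a < m ] (u a * ∑[ b < n ] (v b * w a b))
    ≡⟨ sum-cong-≗ (λ a → *-distribˡ-sum (u a) (λ b → v b * w a b)) ⟩
  ∑[ a < m ] ∑[ b < n ] (u a * (v b * w a b))
    ≡⟨ ∑-comm (λ a b → u a * (v b * w a b)) ⟩
  ∑[ b < n ] ∑[ a < m ] (u a * (v b * w a b))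
    ≡⟨ sum-cong-≗ (λ b → sum-cong-≗ (λ a → x∙yz≈y∙xz *-commutativeSemigroup (u a) (v b) (w a b))) ⟩
  ∑[ b < n ] ∑[ a < m ] (v b * (u a * w a b))
    ≡⟨ sum-cong-≗ (λ b → *-distribˡ-sum (v b) (λ a → u a * w a b)) ⟨
  ∑[ b < n ] (v b * ∑[ a < m ] (u a * w a b))
    ∎

∈⇒1≤length : ∀ {a} {A : Set a} {x : A} {xs : List A} → x ∈ₗ xs → 1 ≤ length xs
∈⇒1≤length (here _)  = s≤s z≤n
∈⇒1≤length (there _) = s≤s z≤n

∣⇒remainder≡0 : ∀ {m c} q {b} .{{_ : NonZero c}} → c ∣ m → m ≡ q * c + b → b < c → b ≡ 0
∣⇒remainder≡0 q {zero}  _   _   _   = refl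
∣⇒remainder≡0 {c = c} q {suc _} c∣m m≡ b<c =
  ⊥-elim (>⇒∤ b<c (∣m+n∣m⇒∣n (subst (c ∣_) m≡ c∣m) (n∣m*n q)))

∣⇒exact : ∀ {m c} q {b} .{{_ : NonZero c}} → c ∣ m → m ≡ q * c + b → b < c → m ≡ q * c
∣⇒exact {c = c} q c∣m m≡ b<c =
  trans m≡ (trans (cong (q * c +_) (∣⇒remainder≡0 q c∣m m≡ b<c)) (+-identityʳ (q * c)))

⌈m*n/n⌉≡m : ∀ m n .{{_ : NonZero n}} → ⌈ m * n / n ⌉ ≡ m
⌈m*n/n⌉≡m m n = begin
  (m * n + (n ∸ 1)) / n    ≡⟨ +-distrib-/-∣ˡ (n ∸ 1) (n∣m*n m) ⟩
  m * n / n + (n ∸ 1) / n  ≡⟨ cong₂ _+_ (m*n/n≡m m n) (m<n⇒m/n≡0 (m≤pred[n]⇒suc[m]≤n ≤-refl)) ⟩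
  m + 0                    ≡⟨ +-identityʳ m ⟩
  m                        ∎

remainder-balanced : ∀ q c (γ : Fin c) → ∑[ i < q * c ] 𝟙 (does (remainder {q} c i ≟ γ)) ≡ q
remainder-balanced q c γ = begin
  ∑[ i < q * c ] 𝟙 (does (remainder {q} c i ≟ γ))
    ≡⟨ ∑-combine q _ ⟩
  ∑[ a < q ] ∑[ j < c ] 𝟙 (does (remainder {q} c (combine a j) ≟ γ))
    ≡⟨ sum-cong-≗ (λ a → sum-cong-≗ λ j →
         cong (λ r → 𝟙 (does (r ≟ γ))) (cong proj₂ (remQuot-combine {q} {c} a j))) ⟩
  ∑[ a < q ] ∑[ j < c ] 𝟙 (does (j ≟ γ))
    ≡⟨ sum-cong-≗ {q} (λ _ → ∑-𝟙-≟≡1 γ) ⟩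
  ∑[ a < q ] 1
    ≡⟨ ∑-ones q ⟩
  q ∎

balancedColouring : ∀ {k} c q → k ≡ q * c →
                    Σ[ col ∈ (Fin k → Fin c) ] ∀ γ → ∑[ i < k ] 𝟙 (does (col i ≟ γ)) ≡ q
balancedColouring c q refl = remainder {q} c , remainder-balanced q c

module _ {k g : ℕ} (T : TD k g) where
  open TD T

  member : Subset (k * g) → Fin (k * g) → ℕ
  member B x = 𝟙 (does (x ∈? B))

  group : Fin k → Subset (k * g)
  group i = tabulate (λ y → does (grp y ≟ i))

  inGroup : Fin k → Fin (k * g) → ℕ
  inGroup i x = 𝟙 (does (grp x ≟ i))

  meet : Subset (k * g) → Fin k → ℕ
  meet B i = ∑[ x < k * g ] (inGroup i x * member B x)

  replication : Fin (k * g) → ℕ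
  replication x = ∑[ b < length blocks ] member (lookup blocks b) x

  ∑-inGroup : ∀ i → ∑[ x < k * g ] inGroup i x ≡ g
  ∑-inGroup i = begin
    ∑[ x < k * g ] inGroup i x
      ≡⟨ sum-cong-≗ (λ x → cong 𝟙 (does-∈?-tabulate x (λ y → does (grp y ≟ i)))) ⟨
    ∑[ x < k * g ] 𝟙 (does (x ∈? group i))
      ≡⟨ ∣p∣≡∑ (group i) ⟨
    groupSize grp i
      ≡⟨ grpSize i ⟩
    g ∎

  pairCount≡∑ : ∀ x y → pairCount blocks x y ≡
                ∑[ b < length blocks ] (member (lookup blocks b) x * member (lookup blocks b) y)
  pairCount≡∑ x y = trans (length-filter≡∑ _ blocks)
    (sum-cong-≗ λ b → 𝟙-∧ (does (x ∈? lookup blocks b)) (does (y ∈? lookup blocks b)))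

  block∩group-unique : ∀ {B x y} → B ∈ₗ blocks → x ∈ B → y ∈ B → grp x ≡ grp y → x ≡ y
  block∩group-unique {B} {x} {y} B∈ x∈B y∈B same with x ≟ y
  ... | yes x≡y = x≡y
  ... | no  x≢y = ⊥-elim (1+n≰n (≤-trans covered (≤-reflexive (samePair x y x≢y same))))
    where
    covered : 1 ≤ pairCount blocks x y
    covered = ∈⇒1≤length (∈-filter⁺ _ B∈ (x∈B , y∈B))

  meet≤1 : ∀ {B} → B ∈ₗ blocks → ∀ i → meet B i ≤ 1
  meet≤1 {B} B∈ i =
    ∑-≤1 _ (λ x → *-mono-≤ (𝟙≤1 (does (grp x ≟ i))) (𝟙≤1 (does (x ∈? B)))) unique
    where
    unique : ∀ x y → inGroup i x * member B x ≡ 1 → inGroup i y * member B y ≡ 1 → x ≡ y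
    unique x y x∈ y∈ = block∩group-unique B∈ (in-B x∈) (in-B y∈) (trans (in-Gᵢ x∈) (sym (in-Gᵢ y∈)))
      where
      in-B : ∀ {z} → inGroup i z * member B z ≡ 1 → z ∈ B
      in-B {z} z∈ = 𝟙-does≡1⇒ (z ∈? B) (m*n≡1⇒n≡1 (inGroup i z) _ z∈)
      in-Gᵢ : ∀ {z} → inGroup i z * member B z ≡ 1 → grp z ≡ i
      in-Gᵢ {z} z∈ = 𝟙-does≡1⇒ (grp z ≟ i) (m*n≡1⇒m≡1 _ (member B z) z∈)

  ∑-meet : ∀ B → ∑[ i < k ] meet B i ≡ ∣ B ∣
  ∑-meet B = begin
    ∑[ i < k ] ∑[ x < k * g ] (inGroup i x * member B x)   ≡⟨ ∑-comm (λ i x → inGroup i x * member B x) ⟩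
    ∑[ x < k * g ] ∑[ i < k ] (inGroup i x * member B x)   ≡⟨ sum-cong-≗ (λ x → ∑-δ (grp x) (λ _ → member B x)) ⟩
    ∑[ x < k * g ] member B x                              ≡⟨ ∣p∣≡∑ B ⟨
    ∣ B ∣                                                  ∎

  meet≡1 : ∀ {B} → B ∈ₗ blocks → ∀ i → meet B i ≡ 1
  meet≡1 {B} B∈ = ∑-mono-≤-≡⇒≗ (meet≤1 B∈) (begin
    ∑[ i < k ] meet B i  ≡⟨ ∑-meet B ⟩
    ∣ B ∣                ≡⟨ blockSize B B∈ ⟩
    k                    ≡⟨ ∑-ones k ⟨
    ∑[ i < k ] 1         ∎)

  replication≡g : ∀ x i → grp x ≢ i → replication x ≡ g
  replication≡g x i x∉Gᵢ = begin
    ∑[ b < r ] member (B b) x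
      ≡⟨ sum-cong-≗ weighted-meet ⟨
    ∑[ b < r ] (member (B b) x * ∑[ y < k * g ] (inGroup i y * member (B b) y))
      ≡⟨ ∑-*-∑-swap (λ b → member (B b) x) (inGroup i) (λ b y → member (B b) y) ⟩
    ∑[ y < k * g ] (inGroup i y * ∑[ b < r ] (member (B b) x * member (B b) y))
      ≡⟨ sum-cong-≗ (λ y → cong (inGroup i y *_) (pairCount≡∑ x y)) ⟨
    ∑[ y < k * g ] (inGroup i y * pairCount blocks x y)
      ≡⟨ sum-cong-≗ paired-with-x ⟩
    ∑[ y < k * g ] (inGroup i y * 1)
      ≡⟨ sum-cong-≗ (λ y → *-identityʳ (inGroup i y)) ⟩
    ∑[ y < k * g ] inGroup i y
      ≡⟨ ∑-inGroup i ⟩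
    g ∎
    where
    r = length blocks
    B = lookup blocks
    weighted-meet : ∀ b → member (B b) x * meet (B b) i ≡ member (B b) x
    weighted-meet b = trans (cong (member (B b) x *_) (meet≡1 (∈-lookup b) i)) (*-identityʳ _)
    paired-with-x : ∀ y → inGroup i y * pairCount blocks x y ≡ inGroup i y * 1
    paired-with-x y = 𝟙-does-*-cong (grp y ≟ i) λ y∈Gᵢ → crossPair x y λ same → x∉Gᵢ (trans same y∈Gᵢ)

  length-blocks : ∀ {i j : Fin k} → i ≢ j → length blocks ≡ g * g
  length-blocks {i} {j} i≢j = begin
    length blocks
      ≡⟨ ∑-ones r ⟨
    ∑[ b < r ] 1
      ≡⟨ sum-cong-≗ (λ b → meet≡1 (∈-lookup b) i) ⟨
    ∑[ b < r ] ∑[ y < k * g ] (inGroup i y * member (B b) y)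
      ≡⟨ ∑-comm (λ b y → inGroup i y * member (B b) y) ⟩
    ∑[ y < k * g ] ∑[ b < r ] (inGroup i y * member (B b) y)
      ≡⟨ sum-cong-≗ (λ y → *-distribˡ-sum (inGroup i y) (λ b → member (B b) y)) ⟨
    ∑[ y < k * g ] (inGroup i y * replication y)
      ≡⟨ sum-cong-≗ replication-on-Gᵢ ⟩
    ∑[ y < k * g ] (inGroup i y * g)
      ≡⟨ *-distribʳ-sum g (inGroup i) ⟨
    (∑[ y < k * g ] inGroup i y) * g
      ≡⟨ cong (_* g) (∑-inGroup i) ⟩
    g * g ∎
    where
    r = length blocks
    B = lookup blocks
    replication-on-Gᵢ : ∀ y → inGroup i y * replication y ≡ inGroup i y * g
    replication-on-Gᵢ y =
      𝟙-does-*-cong (grp y ≟ i) λ y∈Gᵢ → replication≡g y j λ y∈Gⱼ → i≢j (trans (sym y∈Gᵢ) y∈Gⱼ)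

  blocks-isPacking : IsPacking (k * g) k blocks
  blocks-isPacking = blockSize , pairCount≤1
    where
    pairCount≤1 : ∀ x y → x ≢ y → pairCount blocks x y ≤ 1
    pairCount≤1 x y x≢y with grp x ≟ grp y
    ... | yes same = ≤-trans (≤-reflexive (samePair x y x≢y same)) z≤n
    ... | no  diff = ≤-reflexive (crossPair x y diff)

  ∣B∩colourClass∣ : ∀ {c} (col : Fin k → Fin c) {B} → B ∈ₗ blocks → ∀ γ →
                    ∣ B ∩ colourClass (col ∘ grp) γ ∣ ≡ ∑[ i < k ] 𝟙 (does (col i ≟ γ))
  ∣B∩colourClass∣ col {B} B∈ γ = begin
    ∣ B ∩ F ∣
      ≡⟨ ∣p∣≡∑ (B ∩ F) ⟩
    ∑[ x < k * g ] 𝟙 (does (x ∈? B ∩ F))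
      ≡⟨ sum-cong-≗ member-∩ ⟩
    ∑[ x < k * g ] (member B x * χ (grp x))
      ≡⟨ sum-cong-≗ (λ x → cong (member B x *_) (colour-via-groups x)) ⟩
    ∑[ x < k * g ] (member B x * ∑[ i < k ] (χ i * inGroup i x))
      ≡⟨ ∑-*-∑-swap (member B) χ (λ x i → inGroup i x) ⟩
    ∑[ i < k ] (χ i * ∑[ x < k * g ] (member B x * inGroup i x))
      ≡⟨ sum-cong-≗ (λ i → cong (χ i *_) (meets-once i)) ⟩
    ∑[ i < k ] (χ i * 1)
      ≡⟨ sum-cong-≗ (λ i → *-identityʳ (χ i)) ⟩
    ∑[ i < k ] χ i ∎
    where
    F = colourClass (col ∘ grp) γ
    χ : Fin k → ℕ
    χ i = 𝟙 (does (col i ≟ γ))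
    member-∩ : ∀ x → 𝟙 (does (x ∈? B ∩ F)) ≡ member B x * χ (grp x)
    member-∩ x = begin
      𝟙 (does (x ∈? B ∩ F))                  ≡⟨ cong 𝟙 (does-∈?-∩ x B F) ⟩
      𝟙 (does (x ∈? B) ∧ does (x ∈? F))      ≡⟨ 𝟙-∧ (does (x ∈? B)) (does (x ∈? F)) ⟩
      member B x * 𝟙 (does (x ∈? F))         ≡⟨ cong (λ a → member B x * 𝟙 a) (does-∈?-tabulate x _) ⟩
      member B x * χ (grp x)                 ∎
    colour-via-groups : ∀ x → χ (grp x) ≡ ∑[ i < k ] (χ i * inGroup i x)
    colour-via-groups x = trans (sym (∑-δ (grp x) χ)) (sum-cong-≗ λ i → *-comm (inGroup i x) (χ i))
    meets-once : ∀ i → ∑[ x < k * g ] (member B x * inGroup i x) ≡ 1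
    meets-once i = trans (sum-cong-≗ λ x → *-comm (member B x) (inGroup i x)) (meet≡1 B∈ i)

  colourByGroup-equitable : ∀ {c q} .{{_ : NonZero c}} → k ≡ q * c → (col : Fin k → Fin c) →
                            (∀ γ → ∑[ i < k ] 𝟙 (does (col i ≟ γ)) ≡ q) →
                            BlockEquitable k c blocks (col ∘ grp)
  colourByGroup-equitable {c} {q} k≡qc col balanced B B∈ γ =
    ≤-reflexive (trans k/c≡q (sym ∣B∩F∣≡q)) , ≤-reflexive (trans ∣B∩F∣≡q (sym ⌈k/c⌉≡q))
    where
    ∣B∩F∣≡q : ∣ B ∩ colourClass (col ∘ grp) γ ∣ ≡ q
    ∣B∩F∣≡q = trans (∣B∩colourClass∣ col B∈ γ) (balanced γ)
    k/c≡q : k / c ≡ q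
    k/c≡q = trans (cong (_/ c) k≡qc) (m*n/n≡m q c)
    ⌈k/c⌉≡q : ⌈ k / c ⌉ ≡ q
    ⌈k/c⌉≡q = trans (cong (λ m → ⌈ m / c ⌉) k≡qc) (⌈m*n/n⌉≡m q c)

distinctPair : ∀ {k} → 2 ≤ k → Σ[ i ∈ Fin k ] Σ[ j ∈ Fin k ] i ≢ j
distinctPair (s≤s (s≤s _)) = zero , suc zero , 0≢1+n

-- After the substitutions, `2 * 0` and `0 * (0 ∸ 1)` compute to 0, leaving this semiring identity.
blockCount-identity : ∀ g q c d → g * g * (q * (q * c + 0) * d + 0) ≡ q * g * (q * g * c + 0) * d + 0
blockCount-identity = solve-∀

blockCount-formula : ∀ {L g q c b ρ β} d → L ≡ g * g → b ≡ 0 → β ≡ 0 → ρ ≡ q * g →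
  L * (q * (q * c + 2 * b) * d + b * (b ∸ 1)) ≡ ρ * (ρ * c + 2 * β) * d + β * (β ∸ 1)
blockCount-formula {g = g} {q} {c} d refl refl refl refl = blockCount-identity g q c d

theorem2p9 : (k g c : ℕ) .{{_ : NonZero c}} →
    3 ≤ k → 1 ≤ g → 2 ≤ c → TDExists k g → c ∣ k →
    (q b ρ β : ℕ) → k ≡ q * c + b → b < c → k * g ≡ ρ * c + β → β < c →
    Σ (List (Subset (k * g))) λ Bs → Σ (Fin (k * g) → Fin c) λ f →
      IsPacking (k * g) k Bs × BlockEquitable k c Bs f ×
      (length Bs * (q * (q * c + 2 * b) * (c ∸ 1) + b * (b ∸ 1))
        ≡ ρ * (ρ * c + 2 * β) * (c ∸ 1) + β * (β ∸ 1))
theorem2p9 k g c k≥3 _ _ T c∣k q b ρ β k≡qc+b b<c kg≡ρc+β β<c =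
  let (_ , _ , i≢j)    = distinctPair (<⇒≤ k≥3)
      (col , balanced) = balancedColouring c q k≡qc
  in blocks , col ∘ grp , blocks-isPacking T , colourByGroup-equitable T k≡qc col balanced ,
     blockCount-formula {g = g} {q} (c ∸ 1) (length-blocks T i≢j)
       (∣⇒remainder≡0 q c∣k k≡qc+b b<c) (∣⇒remainder≡0 ρ c∣kg kg≡ρc+β β<c) ρ≡qg
  where
  open TD T using (blocks; grp)
  c∣kg : c ∣ k * g
  c∣kg = ∣m⇒∣m*n g c∣k
  k≡qc : k ≡ q * c
  k≡qc = ∣⇒exact q c∣k k≡qc+b b<c
  ρ≡qg : ρ ≡ q * g
  ρ≡qg = *-cancelʳ-≡ ρ (q * g) c (begin
    ρ * c      ≡⟨ ∣⇒exact ρ c∣kg kg≡ρc+β β<c ⟨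
    k * g      ≡⟨ cong (_* g) k≡qc ⟩
    q * c * g  ≡⟨ xy∙z≈xz∙y *-commutativeSemigroup q c g ⟩
    q * g * c  ∎)
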